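{- For each finite set of parameters $\Gamma$, the relation $\sim$ between $\mathbb{C}(\Gamma)$ and $\mathbb{CS}(\Gamma)$ defined by \[ G \sim H_1 \mathtt{a}_1 \ldots \mathtt{a}_{n-1} H_n \iff G = H_n\] is a bisimulation between $C(\Gamma)$ and $CS(\Gamma)$.
   Context: Fix countably infinite disjoint alphabets $\Sigma$ (atomic actions) and $\Pi$ (atomic propositions). The set $\mathbb{E}$ of expressions is given by $e,f ::= \mathtt{a}\in\Sigma \mid \mathtt{p}\in\Pi \mid \mathtt{0} \mid \mathtt{1} \mid e+f \mid e\cdot f \mid e^{\bot} \mid e^{\top} \mid e^{*}$ ($^{\bot}$ antidomain, $^{\top}$ domain). $\equiv$ is the smallest congruence on $\mathbb{E}$ satisfying the Kleene algebra axioms (idempotent semiring laws, $\mathtt{1}+e\cdot e^{*}\leqq e^{*}$, $\mathtt{1}+e^{*}\cdot e\leqq e^{*}$, $f+e\cdot g\leqq g \Rightarrow e^{*}\cdot f\leqq g$, $f+g\cdot e\leqq g\Rightarrow f\cdot e^{*}\leqq g$) together with $e^{\bot}\cdot e\equiv\mathtt{0}$, $(e\cdot f)^{\bot}\equiv(e\cdot f^{\top})^{\bot}$, $e^{\bot}+e^{\top}\equiv\mathtt{1}$, $\mathtt{p}^{\top}\equiv\mathtt{p}$, $e^{\top}\equiv e^{\bot\bot}$; $e\leqq f$ means $e+f\equiv f$. A test is $e^{\top}$ with $e$ containing no $^{\top}$; a parameter is a test or element of $\Pi$. For $\Gamma$ ordered $\phi_1,\dots,\phi_n$, atoms are $\psi_1\cdots\psi_n$,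 $\psi_i\in\{\phi_i,\phi_i^{\bot}\}$ (as products); consistent iff $\not\equiv\mathtt{0}$; $\mathbb{C}(\Gamma)$ = consistent atoms; $\mathbb{CS}(\Gamma)$ = strings $w=G_1\mathtt{a}_1\cdots\mathtt{a}_{n-1}G_n$, $G_i\in\mathbb{C}(\Gamma)$, $\mathtt{a}_j\in\Sigma$; $\mathsf{last}(w)=G_n$. Fusion $xG\diamond Hy=xGy$ if $G=H$ (else undefined). $[\![ \mathtt{a} ]\!]_{\Gamma}=\{G\mathtt{a}H\in\mathbb{CS}(\Gamma)\mid G\mathtt{a}H\not\equiv\mathtt{0}\}$ (canonical $\Gamma$-interpretation of an action). $\mathsf{cay}(L)=\{\langle w,w\diamond u\rangle\mid w\in\mathbb{CS}(\Gamma),u\in L\}$. A relational model is $M=\langle X,\mathsf{rel}_M,\mathsf{sat}_M\rangle$ with $\mathsf{rel}_M:\Sigma\to2^{X\times X}$, $\mathsf{sat}_M:\Pi\to2^X$. $C(\Gamma)$ is the model with universe $\mathbb{C}(\Gamma)$, $\mathsf{rel}_{C(\Gamma)}(\mathtt{a})=\{\langle G,H\rangle\mid G\mathtt{a}H\not\equiv\mathtt{0}\}$, $\mathsf{sat}_{C(\Gamma)}(\mathtt{p})=\{G\mid G\leqq\mathtt{p}\}$. $CS(\Gamma)$ is the model with universe $\mathbb{CS}(\Gamma)$, $\mathsf{rel}_{CS(\Gamma)}(\mathtt{a})=\mathsf{cay}([\![ \mathtt{a} ]\!]_{\Gamma})$, $\mathsf{sat}_{CS(\Gamma)}(\mathtt{p})=\{w\mid\mathsf{last}(w)\leqq\mathtt{p}\}$.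 A bisimulation between $M_1=\langle X_1,\mathsf{rel}_1,\mathsf{sat}_1\rangle$ and $M_2=\langle X_2,\mathsf{rel}_2,\mathsf{sat}_2\rangle$ is a relation $\sim\subseteq X_1\times X_2$ such that $x_1\sim x_2$ implies: $x_1\in\mathsf{sat}_1(\mathtt{p})\iff x_2\in\mathsf{sat}_2(\mathtt{p})$ for all $\mathtt{p}$; if $\langle x_1,y_1\rangle\in\mathsf{rel}_1(\mathtt{a})$ there is $y_2$ with $\langle x_2,y_2\rangle\in\mathsf{rel}_2(\mathtt{a})$ and $y_1\sim y_2$; if $\langle x_2,y_2\rangle\in\mathsf{rel}_2(\mathtt{a})$ there is $y_1$ with $\langle x_1,y_1\rangle\in\mathsf{rel}_1(\mathtt{a})$ and $y_1\sim y_2$. -}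

module Defs where

open import Data.Nat using (ℕ)
open import Data.List using (List; []; _∷_; _++_)
open import Data.Product using (Σ; ∃; _×_; _,_; proj₁)
open import Data.Empty using (⊥)
open import Relation.Nullary using (¬_)
open import Relation.Binary.PropositionalEquality using (_≡_)
open import Function.Bundles using (_⇔_)
open import Data.List.Relation.Unary.All using (All)

-- Alphabets: Σ (atomic actions) and Π (atomic propositions) are both
-- countably infinite; we index each by ℕ.  They are disjoint because
-- they are embedded into expressions by different constructors.

Act : Set
Act = ℕ

Prop : Set
Prop = ℕ

infixl 6 _⊕_
infixl 7 _⊙_
infix 8 _ᗮ _ᵀ _⋆

data Exp : Set where
  act  : Act → Exp
  prop : Prop → Exp
  𝟘    : Exp
  𝟙    : Exp
  _⊕_  : Exp → Exp → Exp
  _⊙_  : Exp → Exp → Exp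
  _ᗮ   : Exp → Exp
  _ᵀ   : Exp → Exp
  _⋆   : Exp → Exp

infix 4 _≈_ _≦_

data _≈_ : Exp → Exp → Set

_≦_ : Exp → Exp → Set
e ≦ f = e ⊕ f ≈ f

data _≈_ where
  ≈-refl  : ∀ {e} → e ≈ e
  ≈-sym   : ∀ {e f} → e ≈ f → f ≈ e
  ≈-trans : ∀ {e f g} → e ≈ f → f ≈ g → e ≈ g
  ⊕-cong : ∀ {e e' f f'} → e ≈ e' → f ≈ f' → e ⊕ f ≈ e' ⊕ f'
  ⊙-cong : ∀ {e e' f f'} → e ≈ e' → f ≈ f' → e ⊙ f ≈ e' ⊙ f'
  ᗮ-cong : ∀ {e e'} → e ≈ e' → e ᗮ ≈ e' ᗮ
  ᵀ-cong : ∀ {e e'} → e ≈ e' → e ᵀ ≈ e' ᵀ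
  ⋆-cong : ∀ {e e'} → e ≈ e' → e ⋆ ≈ e' ⋆
  ⊕-assoc  : ∀ {e f g} → (e ⊕ f) ⊕ g ≈ e ⊕ (f ⊕ g)
  ⊕-comm   : ∀ {e f} → e ⊕ f ≈ f ⊕ e
  ⊕-idem   : ∀ {e} → e ⊕ e ≈ e
  ⊕-identʳ : ∀ {e} → e ⊕ 𝟘 ≈ e
  ⊙-assoc  : ∀ {e f g} → (e ⊙ f) ⊙ g ≈ e ⊙ (f ⊙ g)
  ⊙-identˡ : ∀ {e} → 𝟙 ⊙ e ≈ e
  ⊙-identʳ : ∀ {e} → e ⊙ 𝟙 ≈ e
  ⊙-zeroˡ  : ∀ {e} → 𝟘 ⊙ e ≈ 𝟘
  ⊙-zeroʳ  : ∀ {e} → e ⊙ 𝟘 ≈ 𝟘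
  distribˡ : ∀ {e f g} → e ⊙ (f ⊕ g) ≈ e ⊙ f ⊕ e ⊙ g
  distribʳ : ∀ {e f g} → (f ⊕ g) ⊙ e ≈ f ⊙ e ⊕ g ⊙ e
  ⋆-unfoldˡ : ∀ {e} → 𝟙 ⊕ e ⊙ e ⋆ ≦ e ⋆
  ⋆-unfoldʳ : ∀ {e} → 𝟙 ⊕ e ⋆ ⊙ e ≦ e ⋆
  ⋆-indˡ    : ∀ {e f g} → f ⊕ e ⊙ g ≦ g → e ⋆ ⊙ f ≦ g
  ⋆-indʳ    : ∀ {e f g} → f ⊕ g ⊙ e ≦ g → f ⊙ e ⋆ ≦ g
  ᗮ-annih : ∀ {e} → e ᗮ ⊙ e ≈ 𝟘
  ᗮ-loc   : ∀ {e f} → (e ⊙ f) ᗮ ≈ (e ⊙ f ᵀ) ᗮ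
  ᗮ-compl : ∀ {e} → e ᗮ ⊕ e ᵀ ≈ 𝟙
  ᵀ-prop  : ∀ {p} → prop p ᵀ ≈ prop p
  ᵀ-def   : ∀ {e} → e ᵀ ≈ e ᗮ ᗮ

data NoTop : Exp → Set where
  act  : ∀ {a} → NoTop (act a)
  prop : ∀ {p} → NoTop (prop p)
  𝟘    : NoTop 𝟘
  𝟙    : NoTop 𝟙
  _⊕_  : ∀ {e f} → NoTop e → NoTop f → NoTop (e ⊕ f)
  _⊙_  : ∀ {e f} → NoTop e → NoTop f → NoTop (e ⊙ f)
  _ᗮ   : ∀ {e} → NoTop e → NoTop (e ᗮ)
  _⋆   : ∀ {e} → NoTop e → NoTop (e ⋆)

data Test : Exp → Set where
  test : ∀ {e} → NoTop e → Test (e ᵀ)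

data Param : Exp → Set where
  test : ∀ {e} → Test e → Param e
  prop : ∀ {p} → Param (prop p)

prod : List Exp → Exp
prod []           = 𝟙
prod (x ∷ [])     = x
prod (x ∷ y ∷ xs) = x ⊙ prod (y ∷ xs)

data Choice : List Exp → List Exp → Set where
  []  : Choice [] []
  pos : ∀ {φ Γ ψs} → Choice Γ ψs → Choice (φ ∷ Γ) (φ ∷ ψs)
  neg : ∀ {φ Γ ψs} → Choice Γ ψs → Choice (φ ∷ Γ) (φ ᗮ ∷ ψs)

IsAtom : List Exp → Exp → Set
IsAtom Γ G = ∃ λ ψs → Choice Γ ψs × G ≡ prod ψs

IsCAtom : List Exp → Exp → Set
IsCAtom Γ G = IsAtom Γ G × ¬ (G ≈ 𝟘)

-- Strings G₁ a₁ G₂ ⋯ aₙ₋₁ Gₙ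

record Str : Set where
  constructor mkStr
  field
    first : Exp
    rest  : List (Act × Exp)
open Str public

last : Str → Exp
last w = go (first w) (rest w)
  where
  go : Exp → List (Act × Exp) → Exp
  go G []             = G
  go _ ((_ , H) ∷ xs) = go H xs

InCS : List Exp → Str → Set
InCS Γ w = IsCAtom Γ (first w) × All (λ p → IsCAtom Γ (Data.Product.proj₂ p)) (rest w)

-- Fusion as a (functional) relation:  Fuse w u v  ⇔  w ⋄ u is defined and equals v
Fuse : Str → Str → Str → Set
Fuse w u v = last w ≡ first u × v ≡ mkStr (first w) (rest w ++ rest u)

⟦_⟧ : Act → List Exp → Str → Set
⟦ a ⟧ Γ u = ∃ λ G → ∃ λ H → u ≡ mkStr G ((a , H) ∷ []) × InCS Γ u × ¬ (G ⊙ act a ⊙ H ≈ 𝟘)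

cay : List Exp → (Str → Set) → Str → Str → Set
cay Γ L w v = InCS Γ w × ∃ λ u → L u × Fuse w u v

record Model : Set₁ where
  field
    X   : Set
    rel : Act → X → X → Set
    sat : Prop → X → Set

record IsBisimulation (M₁ M₂ : Model) (R : Model.X M₁ → Model.X M₂ → Set) : Set where
  module M₁ = Model M₁
  module M₂ = Model M₂
  field
    atoms : ∀ {x₁ x₂} → R x₁ x₂ → ∀ p → (M₁.sat p x₁ ⇔ M₂.sat p x₂)
    forth : ∀ {x₁ x₂} → R x₁ x₂ → ∀ a y₁ → M₁.rel a x₁ y₁ →
            ∃ λ y₂ → M₂.rel a x₂ y₂ × R y₁ y₂
    back  : ∀ {x₁ x₂} → R x₁ x₂ → ∀ a y₂ → M₂.rel a x₂ y₂ →
            ∃ λ y₁ → M₁.rel a x₁ y₁ × R y₁ y₂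

CModel : List Exp → Model
CModel Γ = record
  { X   = Σ Exp (IsCAtom Γ)
  ; rel = λ a x y → ¬ (proj₁ x ⊙ act a ⊙ proj₁ y ≈ 𝟘)
  ; sat = λ p x → proj₁ x ≦ prop p
  }

CSModel : List Exp → Model
CSModel Γ = record
  { X   = Σ Str (InCS Γ)
  ; rel = λ a x y → cay Γ (⟦ a ⟧ Γ) (proj₁ x) (proj₁ y)
  ; sat = λ p x → last (proj₁ x) ≦ prop p
  }

_∼_ : ∀ {Γ} → Model.X (CModel Γ) → Model.X (CSModel Γ) → Set
x ∼ y = proj₁ x ≡ last (proj₁ y)

module Submission where

open import Defs
open import Data.List using (List; []; _∷_; _++_; [_])
open import Data.List.Relation.Unary.All using (All; []; _∷_)
open import Data.List.Relation.Unary.All.Properties using (++⁺)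
open import Data.List.Relation.Unary.Unique.Propositional using (Unique)
open import Data.Product using (∃; _×_; _,_)
open import Relation.Binary.PropositionalEquality using (_≡_; refl; sym)
open import Function.Base using (id)
open import Function.Bundles using (_⇔_; mk⇔)

-- A C(Γ)-edge G —a→ H is simulated in CS(Γ) by appending "a H" to a string
-- ending in G; conversely a CS(Γ)-edge fuses with some G a H ∈ ⟦a⟧Γ, i.e.
-- appends one step whose G a H ≢ 0 is a C(Γ)-edge out of the last atom.
-- Only the shape of atoms matters.

_▷_ : Str → Act × Exp → Str
mkStr F xs ▷ step = mkStr F (xs ++ [ step ])

last-▷ : ∀ F xs a H → last (mkStr F xs ▷ (a , H)) ≡ H
last-▷ F []             a H = refl
last-▷ F ((_ , K) ∷ xs) a H = last-▷ K xs a H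

module _ (Γ : List Exp) where
  open Model (CModel Γ) renaming (X to C; rel to relC; sat to satC)
  open Model (CSModel Γ) renaming (X to CS; rel to relCS; sat to satCS)

  _∼Γ_ : C → CS → Set
  _∼Γ_ = _∼_ {Γ}

  ∼-atoms : ∀ {x y} → x ∼Γ y → ∀ p → (satC p x ⇔ satCS p y)
  ∼-atoms refl p = mk⇔ id id

  ∼-forth : ∀ {x y} → x ∼Γ y → ∀ a x′ → relC a x x′ →
            ∃ λ y′ → relCS a y y′ × x′ ∼Γ y′
  ∼-forth {G , G∈ℂ} {w@(mkStr F xs) , (F∈ℂ , xs∈ℂ)} G≡last a (H , H∈ℂ) GaH≢𝟘 =
    (w ▷ (a , H) , F∈ℂ , ++⁺ xs∈ℂ (H∈ℂ ∷ []))
    , ((F∈ℂ , xs∈ℂ) , mkStr G [ a , H ] , aH∈⟦a⟧ , sym G≡last , refl)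
    , sym (last-▷ F xs a H)
    where
    aH∈⟦a⟧ : ⟦ a ⟧ Γ (mkStr G [ a , H ])
    aH∈⟦a⟧ = G , H , refl , (G∈ℂ , H∈ℂ ∷ []) , GaH≢𝟘

  ∼-back : ∀ {x y} → x ∼Γ y → ∀ a y′ → relCS a y y′ →
           ∃ λ x′ → relC a x x′ × x′ ∼Γ y′
  ∼-back {G , _} {mkStr F xs , _} refl a _
         (_ , _ , (_ , H , refl , (_ , H∈ℂ ∷ []) , GaH≢𝟘) , refl , refl) =
    (H , H∈ℂ) , GaH≢𝟘 , sym (last-▷ F xs a H)

lemmaA4 : (Γ : List Exp) → All Param Γ → Unique Γ →
          IsBisimulation (CModel Γ) (CSModel Γ) (_∼_ {Γ})
lemmaA4 Γ _ _ = record
  { atoms = λ {x} {y} → ∼-atoms Γ {x} {y}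
  ; forth = λ {x} {y} → ∼-forth Γ {x} {y}
  ; back  = λ {x} {y} → ∼-back Γ {x} {y}
  }
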